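{- Let $G$ be a group acting sharply $k$-transitively on a finite set $X$ with $n$ elements, and let $\mathbf{x}=(x_1,\ldots,x_n)$ be a sequencing of this action. Then the orbit $\{(gx_1,\ldots,gx_n): g\in G\}$ of $\mathbf{x}$ under $G$ is an $(n,k+1)$-permutation design.
   Context: For a set $X$ and integer $m\ge 1$, $X^{(m)}$ denotes the set of ordered $m$-tuples of distinct elements of $X$; $G$ acts on it coordinatewise. The action of $G$ on $X$ is $k$-transitive if $G$ acts transitively on $X^{(k)}$, and sharply $k$-transitive if moreover, for any $\mathbf{u},\mathbf{v}\in X^{(k)}$, the element $g\in G$ with $g\mathbf{u}=\mathbf{v}$ is unique. A sequencing of a sharply $k$-transitive action of $G$ on an $n$-set $X$ is an enumeration $(x_1,\ldots,x_n)$ of all elements of $X$ (each exactly once) such that the $n-k$ tuples $(x_1,\ldots,x_{k+1}),(x_2,\ldots,x_{k+2}),\ldots,(x_{n-k},\ldots,x_n)$ lie in pairwise distinct orbits of $G$ acting on $X^{(k+1)}$. For integers $n\ge t\ge1$, write $n^{\underline{t}}=n(n-1)\cdots(n-t+1)$. An $(n,t)$-permutation design is a set of $n^{\underline{t-1}}$ permutations (orderings) of an $n$-set such that every ordered $t$-tuple of distinct elements occurs exactly once as a contiguous subsequence of one of the permutations. -}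

module Defs where

open import Level using (Level; _⊔_)
open import Data.Nat using (ℕ; zero; suc; _+_; _∸_; _≤_; _<_)
open import Data.Nat.Properties using (+-monoʳ-<; <-≤-trans)
open import Data.Nat.Combinatorics using (_P_)
open import Data.Fin using (Fin; toℕ; fromℕ<)
open import Data.Fin.Properties using (toℕ<n)
open import Data.Product using (Σ; ∃; _×_; _,_)
open import Function.Definitions using (Injective; Bijective)
open import Relation.Binary.PropositionalEquality using (_≡_; _≗_)
open import Algebra.Bundles using (Group)

record Action {c ℓ : Level} (G : Group c ℓ) (n : ℕ) : Set (c ⊔ ℓ) where
  open Group G
  field
    act      : Carrier → Fin n → Fin n
    act-cong : ∀ {g h} → g ≈ h → ∀ x → act g x ≡ act h x
    act-id   : ∀ x → act ε x ≡ x
    act-comp : ∀ g h x → act (g ∙ h) x ≡ act g (act h x)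

module _ {c ℓ : Level} {G : Group c ℓ} {n : ℕ} (A : Action G n) where
  open Group G
  open Action A

  Maps : ∀ {m} → Carrier → (Fin m → Fin n) → (Fin m → Fin n) → Set
  Maps g u v = ∀ j → act g (u j) ≡ v j

  SameOrbit : ∀ {m} → (Fin m → Fin n) → (Fin m → Fin n) → Set c
  SameOrbit u v = ∃ λ g → Maps g u v

  SharplyTransitive : ℕ → Set (c ⊔ ℓ)
  SharplyTransitive k =
    (∀ (u v : Fin k → Fin n) → Injective _≡_ _≡_ u → Injective _≡_ _≡_ v →
       SameOrbit u v) ×
    (∀ (u v : Fin k → Fin n) (g h : Carrier) →
       Injective _≡_ _≡_ u → Injective _≡_ _≡_ v →
       Maps g u v → Maps h u v → g ≈ h)

-- contiguous window of length t starting at position i (0-based) of s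
window : ∀ {n} {B : Set} (s : Fin n → B) (i t : ℕ) → i + t ≤ n → Fin t → B
window {n} s i t p j = s (fromℕ< (<-≤-trans (+-monoʳ-< i (toℕ<n j)) p))

module _ {c ℓ : Level} {G : Group c ℓ} {n : ℕ} (A : Action G n) where
  open Group G
  open Action A

  IsSequencing : ℕ → (Fin n → Fin n) → Set c
  IsSequencing k x =
    Bijective _≡_ _≡_ x ×
    (∀ (i j : ℕ) (p : i + suc k ≤ n) (q : j + suc k ≤ n) →
       SameOrbit A (window x i (suc k) p) (window x j (suc k) q) → i ≡ j)

  InOrbit : (Fin n → Fin n) → (Fin n → Fin n) → Set c
  InOrbit x σ = ∃ λ g → (λ i → act g (x i)) ≗ σ

-- S (a set of sequences over Fin n, taken up to pointwise equality ≗) is an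
-- (n,t)-permutation design: it consists of permutations, it has exactly
-- n^{(t-1) falling} elements, and every ordered t-tuple of distinct elements
-- occurs exactly once as a contiguous subsequence of a member of S.
record IsPermutationDesign {a : Level} (n t : ℕ) (S : (Fin n → Fin n) → Set a) : Set a where
  field
    perms    : ∀ σ → S σ → Bijective _≡_ _≡_ σ
    enum     : Fin (n P (t ∸ 1)) → (Fin n → Fin n)
    enum-in  : ∀ i → S (enum i)
    enum-sur : ∀ σ → S σ → ∃ λ i → enum i ≗ σ
    enum-inj : ∀ i j → enum i ≗ enum j → i ≡ j
    occurs   : ∀ (u : Fin t → Fin n) → Injective _≡_ _≡_ u →
               Σ (Fin n → Fin n) λ σ → Σ ℕ λ i → Σ (i + t ≤ n) λ p →
                 S σ × window σ i t p ≗ u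
    once     : ∀ (u : Fin t → Fin n) → Injective _≡_ _≡_ u →
               ∀ σ σ′ i i′ (p : i + t ≤ n) (p′ : i′ + t ≤ n) → S σ → S σ′ →
               window σ i t p ≗ u → window σ′ i′ t p′ ≗ u →
               (σ ≗ σ′) × (i ≡ i′)

-- Fix the base tuple b = (0, …, k-1) of X = Fin n. By sharpness, every injective (k+1)-tuple u
-- has a unique g with g·(u₂, …, u_{k+1}) = b, and the point g·u₁, which lies outside b, determines
-- the orbit of u. So G has at most n - k orbits on X^(k+1); the n - k windows of a sequencing lie
-- in distinct orbits, hence meet every orbit exactly once. Translating a window by G moves it to
-- any tuple of its orbit, which gives the occurrence and uniqueness of every (k+1)-tuple in the
-- orbit of x, and sharpness identifies that orbit with G, hence with X^(k), of size n P k.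
module Submission where

open import Defs
open import Level using (Level)
open import Data.Nat as ℕ using (ℕ; zero; suc; _*_; _+_; _∸_; _≤_; _<_; s≤s)
import Data.Nat.Properties as ℕ
open import Data.Nat.Combinatorics using (_P_)
open import Data.Nat.Combinatorics.Base using (_P′_)
open import Data.Nat.Combinatorics.Specification using (nP′k≡n[n∸1P′k∸1])
open import Data.Bool using (true; false)
open import Data.Fin using (Fin; zero; suc; toℕ; fromℕ<; inject≤; cast; punchIn; punchOut; combine; remQuot; _≟_)
open import Data.Fin.Properties
  using (0≢1+n; toℕ-injective; toℕ-fromℕ<; toℕ<n; toℕ-inject≤; inject≤-injective; suc-injective;
         cast-involutive; punchIn-injective; punchInᵢ≢i; punchOut-injective; punchOut-cong;
         punchIn-punchOut; punchOut-punchIn; remQuot-combine; combine-remQuot; any?; injective⇒≤)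
open import Data.Vec.Functional using (head; tail; _∷_)
open import Data.Product using (Σ; ∃; _×_; _,_; proj₁; proj₂)
open import Function using (_∘_)
open import Function.Definitions using (Injective; Bijective; Surjective)
open import Relation.Binary.PropositionalEquality
open import Relation.Nullary using (yes; no; contradiction)
open import Algebra.Bundles using (Group)

fallingFactorial : ℕ → ℕ → ℕ
fallingFactorial n       zero    = 1
fallingFactorial zero    (suc k) = 0
fallingFactorial (suc n) (suc k) = suc n * fallingFactorial n k

fallingFactorial≡P : ∀ {n k} → k ≤ n → fallingFactorial n k ≡ n P k
fallingFactorial≡P {n} {k} k≤n with k ℕ.≤ᵇ n | ℕ.≤⇒≤ᵇ k≤n
... | true | _ = ≡P′ n k k≤n
  where
  ≡P′ : ∀ n k → k ≤ n → fallingFactorial n k ≡ n P′ k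
  ≡P′ n       zero    _         = refl
  ≡P′ (suc n) (suc k) (s≤s k≤n) =
    trans (cong (suc n *_) (≡P′ n k k≤n)) (sym (nP′k≡n[n∸1P′k∸1] (suc n) (suc k)))
... | false | ()

punchOut-cong₂ : ∀ {n} {i i′ j j′ : Fin (suc n)} (i≢j : i ≢ j) (i′≢j′ : i′ ≢ j′) →
                 i ≡ i′ → j ≡ j′ → punchOut i≢j ≡ punchOut i′≢j′
punchOut-cong₂ {i = i} _ _ refl j≡j′ = punchOut-cong i j≡j′

tailPunchedOut : ∀ {n k} (u : Fin (suc k) → Fin (suc n)) → Injective _≡_ _≡_ u → Fin k → Fin n
tailPunchedOut u u-inj j = punchOut {i = u zero} {j = u (suc j)} (0≢1+n ∘ u-inj)

tailPunchedOut-injective : ∀ {n k} (u : Fin (suc k) → Fin (suc n)) (u-inj : Injective _≡_ _≡_ u) →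
                           Injective _≡_ _≡_ (tailPunchedOut u u-inj)
tailPunchedOut-injective u u-inj eq =
  suc-injective (u-inj (punchOut-injective {i = u zero} (0≢1+n ∘ u-inj) (0≢1+n ∘ u-inj) eq))

-- Mixed-radix coding: the head is the leading digit, the punched-out tail the remaining ones.
decode : ∀ n k → Fin (fallingFactorial n k) → Fin k → Fin n
decode (suc n) (suc k) c zero    = proj₁ (remQuot {suc n} (fallingFactorial n k) c)
decode (suc n) (suc k) c (suc j) = punchIn (decode (suc n) (suc k) c zero)
                                           (decode n k (proj₂ (remQuot {suc n} (fallingFactorial n k) c)) j)

encode : ∀ n k (u : Fin k → Fin n) → Injective _≡_ _≡_ u → Fin (fallingFactorial n k)
encode n       zero    u u-inj = zero
encode zero    (suc k) u u-inj with () ← u zero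
encode (suc n) (suc k) u u-inj =
  combine (u zero) (encode n k (tailPunchedOut u u-inj) (tailPunchedOut-injective u u-inj))

decode-injective : ∀ n k c → Injective _≡_ _≡_ (decode n k c)
decode-injective (suc n) (suc k) c {zero}  {zero}  eq = refl
decode-injective (suc n) (suc k) c {zero}  {suc j} eq = contradiction (sym eq) (punchInᵢ≢i _ _)
decode-injective (suc n) (suc k) c {suc i} {zero}  eq = contradiction eq (punchInᵢ≢i _ _)
decode-injective (suc n) (suc k) c {suc i} {suc j} eq =
  cong suc (decode-injective n k _ (punchIn-injective _ _ _ eq))

encode-cong : ∀ n k {u v : Fin k → Fin n} (u-inj : Injective _≡_ _≡_ u) (v-inj : Injective _≡_ _≡_ v) →
              u ≗ v → encode n k u u-inj ≡ encode n k v v-inj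
encode-cong n       zero    _     _     _   = refl
encode-cong zero    (suc k) {u} _ _ _ with () ← u zero
encode-cong (suc n) (suc k) u-inj v-inj u≗v =
  cong₂ combine (u≗v zero)
    (encode-cong n k _ _ (λ j → punchOut-cong₂ _ _ (u≗v zero) (u≗v (suc j))))

decode-encode : ∀ n k (u : Fin k → Fin n) (u-inj : Injective _≡_ _≡_ u) →
                decode n k (encode n k u u-inj) ≗ u
decode-encode zero    (suc k) u u-inj j with () ← u zero
decode-encode (suc n) (suc k) u u-inj zero =
  cong proj₁ (remQuot-combine {suc n} {fallingFactorial n k} (u zero) _)
decode-encode (suc n) (suc k) u u-inj (suc j) = begin
  decode (suc n) (suc k) (combine {suc n} (u zero) c) (suc j)
    ≡⟨ cong (λ (a , r) → punchIn a (decode n k r j)) (remQuot-combine {suc n} {fallingFactorial n k} (u zero) c) ⟩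
  punchIn (u zero) (decode n k c j)
    ≡⟨ cong (punchIn (u zero)) (decode-encode n k _ _ j) ⟩
  punchIn (u zero) (tailPunchedOut u u-inj j)
    ≡⟨ punchIn-punchOut _ ⟩
  u (suc j)
    ∎
  where
  open ≡-Reasoning
  c : Fin (fallingFactorial n k)
  c = encode n k (tailPunchedOut u u-inj) (tailPunchedOut-injective u u-inj)

encode-decode : ∀ n k (c : Fin (fallingFactorial n k)) → encode n k (decode n k c) (decode-injective n k c) ≡ c
encode-decode n       zero    zero = refl
encode-decode (suc n) (suc k) c    = begin
  combine a (encode n k (tailPunchedOut (decode (suc n) (suc k) c) (decode-injective _ _ c)) _)
    ≡⟨ cong (combine a) (encode-cong n k _ _ (λ _ → punchOut-punchIn a)) ⟩
  combine a (encode n k (decode n k r) _)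
    ≡⟨ cong (combine a) (encode-decode n k r) ⟩
  combine a r
    ≡⟨ combine-remQuot {suc n} (fallingFactorial n k) c ⟩
  c
    ∎
  where
  open ≡-Reasoning
  a : Fin (suc n)
  a = proj₁ (remQuot {suc n} (fallingFactorial n k) c)
  r : Fin (fallingFactorial n k)
  r = proj₂ (remQuot {suc n} (fallingFactorial n k) c)

record TupleEnumeration (n k : ℕ) : Set where
  field
    tuple            : Fin (n P k) → Fin k → Fin n
    tuple-injective  : ∀ c → Injective _≡_ _≡_ (tuple c)
    tuple-surjective : ∀ u → Injective _≡_ _≡_ u → ∃ λ c → tuple c ≗ u
    tuple-unique     : ∀ c d → tuple c ≗ tuple d → c ≡ d

injectiveTuples : ∀ {n k} → k ≤ n → TupleEnumeration n k
injectiveTuples {n} {k} k≤n = record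
  { tuple            = λ c → decode n k (from c)
  ; tuple-injective  = λ c → decode-injective n k (from c)
  ; tuple-surjective = λ u u-inj →
      cast count (encode n k u u-inj) ,
      λ j → trans (cong (λ c → decode n k c j) (cast-involutive (sym count) count _)) (decode-encode n k u u-inj j)
  ; tuple-unique     = λ c d c≗d → begin
      c                                               ≡⟨ cast-involutive count (sym count) c ⟨
      cast count (from c)                             ≡⟨ cong (cast count) (encode-decode n k (from c)) ⟨
      cast count (encode n k (decode n k (from c)) _) ≡⟨ cong (cast count) (encode-cong n k _ _ c≗d) ⟩
      cast count (encode n k (decode n k (from d)) _) ≡⟨ cong (cast count) (encode-decode n k (from d)) ⟩
      cast count (from d)                             ≡⟨ cast-involutive count (sym count) d ⟩
      d                                               ∎
  }
  where
  open ≡-Reasoning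
  count : fallingFactorial n k ≡ n P k
  count = fallingFactorial≡P k≤n
  from : Fin (n P k) → Fin (fallingFactorial n k)
  from = cast (sym count)

injective⇒surjective : ∀ {m} {f : Fin m → Fin m} → Injective _≡_ _≡_ f → ∀ y → ∃ λ i → f i ≡ y
injective⇒surjective {zero}  f-inj ()
injective⇒surjective {suc m} {f} f-inj y with any? (λ i → f i ≟ y)
... | yes hit = hit
... | no miss = contradiction (injective⇒≤ punchedOut-injective) ℕ.1+n≰n
  where
  f≢y : ∀ i → y ≢ f i
  f≢y i eq = miss (i , sym eq)
  punchedOut-injective : Injective _≡_ _≡_ (λ i → punchOut (f≢y i))
  punchedOut-injective eq = f-inj (punchOut-injective (f≢y _) (f≢y _) eq)

window-injective : ∀ {n m} {s : Fin n → Fin m} → Injective _≡_ _≡_ s →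
                   ∀ i t (p : i + t ≤ n) → Injective _≡_ _≡_ (window s i t p)
window-injective s-inj i t p eq = toℕ-injective (ℕ.+-cancelˡ-≡ i _ _
  (trans (sym (toℕ-fromℕ< _)) (trans (cong toℕ (s-inj eq)) (toℕ-fromℕ< _))))

module _ {c ℓ : Level} {G : Group c ℓ} {n : ℕ} (A : Action G n) where
  open Group G using (_∙_; _⁻¹; inverseˡ; inverseʳ)
  open Action A

  act-inverseˡ : ∀ g y → act (g ⁻¹) (act g y) ≡ y
  act-inverseˡ g y = trans (sym (act-comp _ _ y)) (trans (act-cong (inverseˡ g) y) (act-id y))

  act-inverseʳ : ∀ g y → act g (act (g ⁻¹) y) ≡ y
  act-inverseʳ g y = trans (sym (act-comp _ _ y)) (trans (act-cong (inverseʳ g) y) (act-id y))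

  act-injective : ∀ g → Injective _≡_ _≡_ (act g)
  act-injective g {a} {b} eq = trans (sym (act-inverseˡ g a)) (trans (cong (act (g ⁻¹)) eq) (act-inverseˡ g b))

  act∘-injective : ∀ g {m} {u : Fin m → Fin n} → Injective _≡_ _≡_ u → Injective _≡_ _≡_ (act g ∘ u)
  act∘-injective g u-inj = u-inj ∘ act-injective g

  maps-through : ∀ {m} {g h} {u v w : Fin m → Fin n} → Maps A g u w → Maps A h v w → Maps A (h ⁻¹ ∙ g) u v
  maps-through {g = g} {h} {u} {v} g↦ h↦ j = begin
    act (h ⁻¹ ∙ g) (u j)     ≡⟨ act-comp _ _ _ ⟩
    act (h ⁻¹) (act g (u j)) ≡⟨ cong (act (h ⁻¹)) (trans (g↦ j) (sym (h↦ j))) ⟩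
    act (h ⁻¹) (act h (v j)) ≡⟨ act-inverseˡ h (v j) ⟩
    v j                      ∎
    where open ≡-Reasoning

  agree-on-image : ∀ {g h} {x : Fin n → Fin n} → Surjective _≡_ _≡_ x →
                   (act g ∘ x) ≗ (act h ∘ x) → ∀ y → act g y ≡ act h y
  agree-on-image x-sur gx≗hx y with i , xi≡y ← x-sur y = subst (λ z → act _ z ≡ act _ z) (xi≡y refl) (gx≗hx i)

  orbit-bijective : ∀ {x σ} → Bijective _≡_ _≡_ x → InOrbit A x σ → Bijective _≡_ _≡_ σ
  orbit-bijective {x} {σ} (x-inj , x-sur) (g , gx≗σ) = σ-inj , σ-sur
    where
    σ-inj : Injective _≡_ _≡_ σ
    σ-inj {a} {b} eq = x-inj (act-injective g (trans (gx≗σ a) (trans eq (sym (gx≗σ b)))))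
    σ-sur : Surjective _≡_ _≡_ σ
    σ-sur y with i , xi≡ ← x-sur (act (g ⁻¹) y) =
      i , λ { refl → trans (sym (gx≗σ i)) (trans (cong (act g) (xi≡ refl)) (act-inverseʳ g y)) }

module Sharp {c ℓ : Level} {G : Group c ℓ} {n k : ℕ} (A : Action G n) (k≤n : k ≤ n)
             (sharp : SharplyTransitive A k) where
  open Group G using (Carrier; _≈_)
  open Action A
  open Σ sharp renaming (proj₁ to transitive; proj₂ to unique)

  base : Fin k → Fin n
  base j = inject≤ j k≤n

  base-injective : Injective _≡_ _≡_ base
  base-injective = inject≤-injective _ _ _ _

  standardiser : (u : Fin k → Fin n) → Injective _≡_ _≡_ u → Carrier
  standardiser u u-inj = proj₁ (transitive u base u-inj base-injective)

  standardiser-maps : ∀ u (u-inj : Injective _≡_ _≡_ u) → Maps A (standardiser u u-inj) u base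
  standardiser-maps u u-inj = proj₂ (transitive u base u-inj base-injective)

  -- A complete invariant of the orbit of an injective (k+1)-tuple: normalHead avoids the base,
  -- so subtracting k lands in Fin (n ∸ k).
  module _ (u : Fin (suc k) → Fin n) (u-inj : Injective _≡_ _≡_ u) where
    private
      tail-inj : Injective _≡_ _≡_ (tail u)
      tail-inj = suc-injective ∘ u-inj

      g : Carrier
      g = standardiser (tail u) tail-inj

    normalHead : Fin n
    normalHead = act g (head u)

    k≤normalHead : k ≤ toℕ normalHead
    k≤normalHead with toℕ normalHead ℕ.<? k
    ... | no ≮k = ℕ.≮⇒≥ ≮k
    ... | yes <k = contradiction (u-inj (act-injective A g (trans (standardiser-maps _ _ j) base-j≡))) λ ()
      where
      j : Fin k
      j = fromℕ< <k
      base-j≡ : base j ≡ normalHead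
      base-j≡ = toℕ-injective (trans (toℕ-inject≤ j k≤n) (toℕ-fromℕ< <k))

    orbitIndex : Fin (n ∸ k)
    orbitIndex = fromℕ< (ℕ.∸-monoˡ-< (toℕ<n normalHead) k≤normalHead)

    standardiser-extends : Maps A g u (normalHead ∷ base)
    standardiser-extends zero    = refl
    standardiser-extends (suc j) = standardiser-maps _ _ j

  sameOrbit-orbitIndex : ∀ {u v} (u-inj : Injective _≡_ _≡_ u) (v-inj : Injective _≡_ _≡_ v) →
                         orbitIndex u u-inj ≡ orbitIndex v v-inj → SameOrbit A u v
  sameOrbit-orbitIndex {u} {v} u-inj v-inj eq = _ , maps-through A (standardiser-extends u u-inj) v↦
    where
    normalHead-≡ : normalHead u u-inj ≡ normalHead v v-inj
    normalHead-≡ = toℕ-injective (ℕ.∸-cancelʳ-≡ (k≤normalHead u u-inj) (k≤normalHead v v-inj)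
      (trans (sym (toℕ-fromℕ< _)) (trans (cong toℕ eq) (toℕ-fromℕ< _))))
    v↦ : Maps A _ v (normalHead u u-inj ∷ base)
    v↦ zero    = trans (standardiser-extends v v-inj zero) (sym normalHead-≡)
    v↦ (suc j) = standardiser-extends v v-inj (suc j)

  maps-unique : ∀ {g h} {u v : Fin k → Fin n} → Injective _≡_ _≡_ u →
               Maps A g u v → Maps A h u v → g ≈ h
  maps-unique {u = u} {v} u-inj g↦ h↦ = unique u v _ _ u-inj v-inj g↦ h↦
    where
    v-inj : Injective _≡_ _≡_ v
    v-inj {a} {b} eq = u-inj (act-injective A _ (trans (g↦ a) (trans eq (sym (g↦ b)))))

  -- Sharpness identifies the orbit of x with G, and G with X^(k) via g ↦ g ∘ base.
  module Orbit (x : Fin n → Fin n) (x-bij : Bijective _≡_ _≡_ x) where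
    open TupleEnumeration (injectiveTuples k≤n)

    elementOf : Fin (n P k) → Carrier
    elementOf c = proj₁ (transitive base (tuple c) base-injective (tuple-injective c))

    elementOf-maps : ∀ c → Maps A (elementOf c) base (tuple c)
    elementOf-maps c = proj₂ (transitive base (tuple c) base-injective (tuple-injective c))

    member : Fin (n P k) → Fin n → Fin n
    member c = act (elementOf c) ∘ x

    member-surjective : ∀ σ → InOrbit A x σ → ∃ λ c → member c ≗ σ
    member-surjective σ (g , gx≗σ)
      with c , tuple≗ ← tuple-surjective (act g ∘ base) (act∘-injective A g base-injective) =
      c , λ m → trans (act-cong c≈g (x m)) (gx≗σ m)
      where
      c≈g : elementOf c ≈ g
      c≈g = maps-unique base-injective (λ j → trans (elementOf-maps c j) (tuple≗ j)) (λ _ → refl)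

    member-unique : ∀ c d → member c ≗ member d → c ≡ d
    member-unique c d c≗d = tuple-unique c d λ j → begin
      tuple c j                  ≡⟨ elementOf-maps c j ⟨
      act (elementOf c) (base j) ≡⟨ agree-on-image A (proj₂ x-bij) c≗d (base j) ⟩
      act (elementOf d) (base j) ≡⟨ elementOf-maps d j ⟩
      tuple d j                  ∎
      where open ≡-Reasoning

  module Windows (x : Fin n → Fin n) (x-inj : Injective _≡_ _≡_ x)
                 (distinct : ∀ i j p q → SameOrbit A (window x i (suc k) p) (window x j (suc k) q) → i ≡ j) where

    windowFits : ∀ {i} → i < n ∸ k → i + suc k ≤ n
    windowFits {i} i<n∸k =
      subst (_≤ n) (sym (ℕ.+-suc i k)) (subst (suc i + k ≤_) (ℕ.m∸n+n≡m k≤n) (ℕ.+-monoˡ-≤ k i<n∸k))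

    windowAt : Fin (n ∸ k) → Fin (suc k) → Fin n
    windowAt i = window x (toℕ i) (suc k) (windowFits (toℕ<n i))

    windowAt-injective : ∀ i → Injective _≡_ _≡_ (windowAt i)
    windowAt-injective i = window-injective x-inj (toℕ i) (suc k) (windowFits (toℕ<n i))

    windowIndex : Fin (n ∸ k) → Fin (n ∸ k)
    windowIndex i = orbitIndex (windowAt i) (windowAt-injective i)

    windowIndex-injective : Injective _≡_ _≡_ windowIndex
    windowIndex-injective {i} {j} eq =
      toℕ-injective (distinct _ _ (windowFits (toℕ<n i)) (windowFits (toℕ<n j))
        (sameOrbit-orbitIndex (windowAt-injective i) (windowAt-injective j) eq))

    window-meets-orbit : ∀ u → Injective _≡_ _≡_ u → ∃ λ i → SameOrbit A (windowAt i) u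
    window-meets-orbit u u-inj with i , eq ← injective⇒surjective windowIndex-injective (orbitIndex u u-inj) =
      i , sameOrbit-orbitIndex (windowAt-injective i) u-inj eq

    window-translate-unique : ∀ {g g′ u} i i′ p p′ → Injective _≡_ _≡_ u →
                              Maps A g (window x i (suc k) p) u → Maps A g′ (window x i′ (suc k) p′) u →
                              g ≈ g′ × i ≡ i′
    window-translate-unique {g} {g′} i i′ p p′ u-inj g↦ g′↦
      with refl ← distinct i i′ p p′ (_ , maps-through A g↦ g′↦) =
      maps-unique (suc-injective ∘ window-injective x-inj i (suc k) p) (g↦ ∘ suc) (g′↦ ∘ suc) , refl

    occurs : ∀ u → Injective _≡_ _≡_ u →
             Σ (Fin n → Fin n) λ σ → Σ ℕ λ i → Σ (i + suc k ≤ n) λ p → InOrbit A x σ × window σ i (suc k) p ≗ u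
    occurs u u-inj = let i , g , g↦ = window-meets-orbit u u-inj in
      act g ∘ x , toℕ i , windowFits (toℕ<n i) , (g , λ _ → refl) , g↦

    occurs-once : ∀ u → Injective _≡_ _≡_ u → ∀ σ σ′ i i′ (p : i + suc k ≤ n) (p′ : i′ + suc k ≤ n) →
                  InOrbit A x σ → InOrbit A x σ′ → window σ i (suc k) p ≗ u → window σ′ i′ (suc k) p′ ≗ u →
                  σ ≗ σ′ × i ≡ i′
    occurs-once u u-inj σ σ′ i i′ p p′ (g , gx≗σ) (g′ , g′x≗σ′) σ↦u σ′↦u =
      (λ m → trans (sym (gx≗σ m)) (trans (act-cong (proj₁ g≈g′×i≡i′) (x m)) (g′x≗σ′ m))) , proj₂ g≈g′×i≡i′
      where
      g≈g′×i≡i′ : g ≈ g′ × i ≡ i′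
      g≈g′×i≡i′ = window-translate-unique i i′ p p′ u-inj (λ j → trans (gx≗σ _) (σ↦u j))
                                                        (λ j → trans (g′x≗σ′ _) (σ′↦u j))

theorem3p1 : ∀ {c ℓ : Level} (G : Group c ℓ) (n k : ℕ) (A : Action G n) →
    1 ≤ k → suc k ≤ n →
    SharplyTransitive A k →
    (x : Fin n → Fin n) → IsSequencing A k x →
    IsPermutationDesign n (suc k) (InOrbit A x)
theorem3p1 G n k A _ sk≤n sharp x (x-bij , distinct) = record
  { perms    = λ σ → orbit-bijective A x-bij
  ; enum     = member
  ; enum-in  = λ c → elementOf c , λ _ → refl
  ; enum-sur = member-surjective
  ; enum-inj = member-unique
  ; occurs   = occurs
  ; once     = occurs-once
  }
  where
  open Sharp A (ℕ.<⇒≤ sk≤n) sharp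
  open Orbit x x-bij
  open Windows x (proj₁ x-bij) distinct
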